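{- Let $\Lambda$ be any set of monotone predicate liftings for a set functor $\mathsf{T}$. Every second-order $\Lambda$-automaton $\mathbb{A}$ is equivalent over $\mathsf{T}$-tree models to a monotone second-order $\Lambda$-automaton, i.e. one in which every one-step formula $\Delta(a,c)$ is monotone.
   Context: Predicate lifting: natural transformation $\lambda:\mathcal{Q}(-)^n\to\mathcal{Q}\circ\mathsf{T}$, monotone if componentwise monotone. One-step model $(X,\alpha,V)$, $\alpha\in\mathsf{T}X$, $V:A\to\mathcal{P}X$. Second-order one-step formulas over $A\cup\mathit{Var}_1$ ($\mathit{Var}_1$ an infinite set of one-step variables): $\varphi::=a\subseteq b\mid\lambda(a_1,..,a_n)\mid\neg\varphi\mid\varphi\vee\varphi\mid\exists a.\varphi$, $\lambda\in\Lambda$; $\vDash_1 a\subseteq b$ iff $V(a)\subseteq V(b)$, $\lambda(\vec a)$ iff $\alpha\in\lambda_X(V(a_1),..)$, $\exists a$ quantifies over subsets of $X$. $\mathtt{SO}^1_\Lambda(A)$ = those with free variables in $A$. Such a formula is monotone if, whenever $(X,\alpha,V)\vDash_1\varphi$ and $V(a)\subseteq V'(a)$ for all $a\in A$, also $(X,\alpha,V')\vDash_1\varphi$. A $P$-chromatic second-order $\Lambda$-automaton is $(A,\Delta,\Omega,a_I)$, $A$ finite, $a_I\in A$, $\Omega:A\to\omega$, $\Delta:A\times\mathcal{P}(P)\to\mathtt{SO}^1_\Lambda(A)$. $\mathsf{T}$-tree model $(S,\sigma,V,R,u)$: $\mathsf{T}$-model with $R(s)$ supporting $\sigma(s)$ for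 every $s$ (i.e. $\sigma(s)=\mathsf{T}\iota(\beta_s)$ for some $\beta_s\in\mathsf{T}(R(s))$) and $(S,R)$ a tree rooted at $u$. Acceptance game: at $(a,s)$, $\exists$ picks $U:A\to\mathcal{P}(R(s))$ with $(R(s),\beta_s,U)\vDash_1\Delta(a,V^\dagger(s)\cap P)$, then $\forall$ picks $(b,t)$ with $t\in U(b)$; stuck player loses, infinite match won by $\exists$ iff the greatest parity occurring infinitely often is even; acceptance = $\exists$ wins from $(a_I,u)$. Two automata are equivalent over tree models if they accept the same $\mathsf{T}$-tree models. -}

module Defs where

open import Level using (Level; 0ℓ) renaming (suc to lsuc)
open import Data.Nat using (ℕ; zero; suc; _≤_; _%_)
open import Data.Fin using (Fin)
open import Data.Fin.Subset using (Subset)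
open import Data.Product using (Σ; _×_; _,_; proj₁; proj₂)
open import Data.Sum using (_⊎_)
open import Data.List using (List; []; _∷_; _++_; [_]; map; upTo)
open import Data.Vec.Functional using (Vector) renaming (_∷_ to _∷ᵥ_)
open import Relation.Nullary using (¬_)
open import Relation.Unary using (Pred; _⊆_)
open import Relation.Binary.PropositionalEquality using (_≡_)
open import Function using (_∘_; id)
open import Function.Bundles using (_⇔_)

record SetFunctor : Set₁ where
  field
    F       : Set → Set
    fmap    : {X Y : Set} → (X → Y) → F X → F Y
    fmap-id : {X : Set} (t : F X) → fmap id t ≡ t
    fmap-∘  : {X Y Z : Set} (g : Y → Z) (f : X → Y) (t : F X) →
              fmap (g ∘ f) t ≡ fmap g (fmap f t)

Subsetˢ : Set → Set₁
Subsetˢ X = Pred X 0ℓ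

record PredLifting (T : SetFunctor) : Set₁ where
  open SetFunctor T
  field
    arity   : ℕ
    lift    : {X : Set} → (Fin arity → Subsetˢ X) → Subsetˢ (F X)
    natural : {X Y : Set} (f : X → Y) (U : Fin arity → Subsetˢ Y) (t : F X) →
              lift (λ i → U i ∘ f) t ⇔ lift U (fmap f t)

MonotoneLifting : {T : SetFunctor} → PredLifting T → Set₁
MonotoneLifting {T} λ' =
  {X : Set} (U U′ : Fin (PredLifting.arity λ') → Subsetˢ X) →
  (∀ i → U i ⊆ U′ i) → PredLifting.lift λ' U ⊆ PredLifting.lift λ' U′

-- Variables are de Bruijn:
-- Form n has variables Fin n; ∃ binds a fresh variable (index zero).

module OneStep (T : SetFunctor) {L : Set} (Λ : L → PredLifting T) where
  open SetFunctor T

  data Form (n : ℕ) : Set where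
    _⊆ᶠ_ : Fin n → Fin n → Form n
    lft  : (l : L) → (Fin (PredLifting.arity (Λ l)) → Fin n) → Form n
    neg  : Form n → Form n
    _∨ᶠ_ : Form n → Form n → Form n
    exᶠ  : Form (suc n) → Form n

  Sat : {n : ℕ} (X : Set) (α : F X) (V : Fin n → Subsetˢ X) → Form n → Set₁
  Sat X α V (a ⊆ᶠ b)  = Level.Lift (lsuc 0ℓ) (V a ⊆ V b)
  Sat X α V (lft l as) = Level.Lift (lsuc 0ℓ) (PredLifting.lift (Λ l) (V ∘ as) α)
  Sat X α V (neg φ)   = ¬ Sat X α V φ
  Sat X α V (φ ∨ᶠ ψ)  = Sat X α V φ ⊎ Sat X α V ψ
  Sat X α V (exᶠ φ)   = Σ (Subsetˢ X) λ U → Sat X α (U ∷ᵥ V) φ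

  MonotoneForm : {n : ℕ} → Form n → Set₁
  MonotoneForm {n} φ = (X : Set) (α : F X) (V V′ : Fin n → Subsetˢ X) →
    (∀ a → V a ⊆ V′ a) → Sat X α V φ → Sat X α V′ φ

  -- T-tree models, coloured by P = Fin m (V†(s) ∩ P given as col s)

  IsPath : {S : Set} → (S → S → Set) → S → List S → S → Set
  IsPath R u []       s = u ≡ s
  IsPath R u (x ∷ xs) s = R u x × IsPath R x xs s

  record TreeModel (m : ℕ) : Set₁ where
    field
      S      : Set
      σ      : S → F S
      col    : S → Subset m
      R      : S → S → Set
      R-prop : ∀ {s t} (p q : R s t) → p ≡ q   -- R is a relation (proof-irrelevant)
      u      : S
      -- R(s) supports σ(s): σ(s) = Tι(β_s), β_s ∈ T(R(s))
      β      : (s : S) → F (Σ S (R s))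
      supp   : (s : S) → fmap proj₁ (β s) ≡ σ s
      tree   : (s : S) → Σ (List S) λ p → IsPath R u p s × (∀ q → IsPath R u q s → q ≡ p)

  record Automaton (m : ℕ) : Set where
    field
      k  : ℕ
      Δ  : Fin k → Subset m → Form k
      Ω  : Fin k → ℕ
      aI : Fin k

  MonotoneAutomaton : {m : ℕ} → Automaton m → Set₁
  MonotoneAutomaton 𝔸 = ∀ a c → MonotoneForm (Automaton.Δ 𝔸 a c)

  Even : ℕ → Set
  Even n = n % 2 ≡ 0

  ParityWin : (ℕ → ℕ) → Set
  ParityWin π = Σ ℕ λ M → Even M ×
    ((∀ N → Σ ℕ λ j → N ≤ j × π j ≡ M) ×
     (Σ ℕ λ N → ∀ j → N ≤ j → π j ≤ M))

  module Game {m : ℕ} (𝔸 : Automaton m) (𝕊 : TreeModel m) where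
    open Automaton 𝔸
    open TreeModel 𝕊

    Pos : Set
    Pos = Fin k × S

    -- a (possibly illegal) move of ∃ at position (a , s): U : A → P(R(s))
    Choice : Pos → Set₁
    Choice (a , s) = Fin k → Subsetˢ (Σ S (R s))

    Legal : (p : Pos) → Choice p → Set₁
    Legal (a , s) U = Sat (Σ S (R s)) (β s) U (Δ a (col s))

    Answer : (p : Pos) → Choice p → Pos → Set
    Answer (a , s) U (b , t) = Σ (R s t) λ r → U b (t , r)

    Strategy : Set₁
    Strategy = (h : List Pos) (p : Pos) → Choice p

    data Reach (f : Strategy) (p₀ : Pos) : List Pos → Pos → Set₁ where
      start : Reach f p₀ [] p₀
      step  : ∀ {h p q} → Reach f p₀ h p → Answer p (f h p) q →
              Reach f p₀ (h ++ [ p ]) q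

    InfPlay : Strategy → Pos → (ℕ → Pos) → Set
    InfPlay f p₀ ρ = (ρ 0 ≡ p₀) ×
      (∀ i → Answer (ρ i) (f (map ρ (upTo i)) (ρ i)) (ρ (suc i)))

    -- f is winning for ∃ from p₀: ∃ never gets stuck (always a legal
    -- move; ∀ getting stuck is a win for ∃), and every infinite play
    -- satisfies the parity condition
    Winning : Strategy → Pos → Set₁
    Winning f p₀ =
      (∀ {h p} → Reach f p₀ h p → Legal p (f h p)) ×
      (∀ ρ → InfPlay f p₀ ρ → ParityWin (λ i → Ω (proj₁ (ρ i))))

    Accepts : Set₁
    Accepts = Σ Strategy λ f → Winning f (aI , u)

  Accepts : {m : ℕ} → Automaton m → TreeModel m → Set₁
  Accepts 𝔸 𝕊 = Game.Accepts 𝔸 𝕊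

  EquivOverTrees : {m : ℕ} → Automaton m → Automaton m → Set₁
  EquivOverTrees {m} 𝔸 𝔹 = (𝕊 : TreeModel m) → Accepts 𝔸 𝕊 ⇔ Accepts 𝔹 𝕊

module Submission where

-- Every one-step formula φ(a⃗) is replaced by its monotone closure
--   Mon φ (a⃗)  =  ∃ b⃗. (⋀ᵢ bᵢ ⊆ aᵢ) ∧ φ(b⃗),
-- which holds under V iff φ holds under some valuation below V.  Mon φ is
-- monotone by construction, and φ implies Mon φ.  The automaton obtained by
-- closing every transition formula accepts the same tree models: a winning
-- strategy for 𝔸 is still winning for the closure (its moves stay legal), and
-- a winning strategy for the closure is turned into one for 𝔸 by shrinking
-- each move to a witness valuation below it.  Shrinking ∃'s moves only
-- shrinks ∀'s options, so every play of the new strategy is a play of the old.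

open import Defs
open import Level using (Level; 0ℓ; lift; lower) renaming (suc to lsuc)
open import Data.Product using (Σ; _×_; _,_; proj₁; proj₂)
open import Data.Sum using (inj₁; inj₂)
open import Data.Empty using (⊥-elim)
open import Data.Nat using (ℕ; zero; suc; _+_)
open import Data.Fin using (Fin; zero; suc; _↑ˡ_; _↑ʳ_) renaming (lift to liftFin)
open import Data.Fin.Subset using (Subset)
open import Data.List using (List; map; upTo)
open import Data.Vec.Functional using (Vector; head; tail) renaming (_∷_ to _∷ᵥ_)
open import Relation.Nullary using (yes; no)
open import Relation.Nullary.Decidable using (decidable-stable)
open import Relation.Unary using (_⊆_; _≐_)
open import Relation.Unary.Properties using (≐-refl)
open import Relation.Binary.PropositionalEquality using (_≡_; refl; sym; subst)
open import Function using (_∘_; id)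
open import Function.Bundles using (_⇔_; mk⇔; Equivalence)
open import Function.Properties.Equivalence using () renaming (trans to ⇔-trans)
open import Data.Product.Function.NonDependent.Propositional using (_×-⇔_)
open import Axiom.ExcludedMiddle using (ExcludedMiddle)

open Equivalence using (to; from)

-- W ⊕ V lists the values of W and then those of V.  Defined by recursion on
-- the length of W so that (U ∷ W) ⊕ V and U ∷ (W ⊕ V) agree definitionally.
_⊕_ : ∀ {a} {A : Set a} {j n : ℕ} → Vector A j → Vector A n → Vector A (j + n)
_⊕_ {j = zero}  W V = V
_⊕_ {j = suc j} W V = head W ∷ᵥ (tail W ⊕ V)

⊕-↑ˡ : ∀ {a} {A : Set a} {j n : ℕ} (W : Vector A j) (V : Vector A n) (i : Fin j) →
       (W ⊕ V) (i ↑ˡ n) ≡ W i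
⊕-↑ˡ W V zero    = refl
⊕-↑ˡ W V (suc i) = ⊕-↑ˡ (tail W) V i

⊕-↑ʳ : ∀ {a} {A : Set a} {j n : ℕ} (W : Vector A j) (V : Vector A n) (i : Fin n) →
       (W ⊕ V) (j ↑ʳ i) ≡ V i
⊕-↑ʳ {j = zero}  W V i = refl
⊕-↑ʳ {j = suc j} W V i = ⊕-↑ʳ (tail W) V i

⊆-subst : {X : Set} {P P′ Q Q′ : Subsetˢ X} → P ≡ P′ → Q ≡ Q′ → P ⊆ Q → P′ ⊆ Q′
⊆-subst refl refl P⊆Q = P⊆Q

module Formulas (T : SetFunctor) {L : Set} (Λ : L → PredLifting T) where
  open SetFunctor T
  open OneStep T Λ

  ren : ∀ {n n′} → (Fin n → Fin n′) → Form n → Form n′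
  ren ρ (a ⊆ᶠ b)   = ρ a ⊆ᶠ ρ b
  ren ρ (lft l as) = lft l (ρ ∘ as)
  ren ρ (neg φ)    = neg (ren ρ φ)
  ren ρ (φ ∨ᶠ ψ)   = ren ρ φ ∨ᶠ ren ρ ψ
  ren ρ (exᶠ φ)    = exᶠ (ren (liftFin 1 ρ) φ)

  exs : ∀ j {n} → Form (j + n) → Form n
  exs zero    φ = φ
  exs (suc j) φ = exs j (exᶠ φ)

  sat-exs : ∀ j {n X} {α : F X} (V : Fin n → Subsetˢ X) (φ : Form (j + n)) →
            Sat X α V (exs j φ) ⇔ Σ (Vector (Subsetˢ X) j) λ W → Sat X α (W ⊕ V) φ
  sat-exs zero    V φ = mk⇔ (λ s → (λ ()) , s) proj₂
  sat-exs (suc j) V φ = mk⇔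
    (λ s → let (W , U , sφ) = to (sat-exs j V (exᶠ φ)) s in U ∷ᵥ W , sφ)
    (λ (W , sφ) → from (sat-exs j V (exᶠ φ)) (tail W , head W , sφ))

  _∧ᶠ_ : ∀ {n} → Form n → Form n → Form n
  φ ∧ᶠ ψ = neg (neg φ ∨ᶠ neg ψ)

  conjoin : ∀ j {n} → (Fin j → Form n) → Form n → Form n
  conjoin zero    f ψ = ψ
  conjoin (suc j) f ψ = head f ∧ᶠ conjoin j (tail f) ψ

  -- The constraints bᵢ ⊆ aᵢ, where the bᵢ are the first k variables of
  -- Form (k + k) and the aᵢ the last k.
  bounds : ∀ k → Fin k → Form (k + k)
  bounds k i = (i ↑ˡ k) ⊆ᶠ (k ↑ʳ i)

  Mon : ∀ {k} → Form k → Form k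
  Mon {k} φ = exs k (conjoin k (bounds k) (ren (_↑ˡ k) φ))

  -- Renaming is sound when the renamed valuation agrees with the original
  -- up to extensional equality of subsets; monotone liftings are needed so
  -- that lifted predicates respect this equality.
  module _ (mono : ∀ l → MonotoneLifting (Λ l)) where

    sat-ren : ∀ {n n′ X} {α : F X} (ρ : Fin n → Fin n′)
              (V : Fin n′ → Subsetˢ X) (W : Fin n → Subsetˢ X) →
              (∀ i → V (ρ i) ≐ W i) → (φ : Form n) →
              Sat X α V (ren ρ φ) ⇔ Sat X α W φ
    sat-ren ρ V W V≐W (a ⊆ᶠ b) = mk⇔
      (λ s → lift (λ {x} x∈ → proj₁ (V≐W b) (lower s (proj₂ (V≐W a) x∈))))
      (λ s → lift (λ {x} x∈ → proj₂ (V≐W b) (lower s (proj₁ (V≐W a) x∈))))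
    sat-ren ρ V W V≐W (lft l as) = mk⇔
      (λ s → lift (mono l _ _ (λ i → proj₁ (V≐W (as i))) (lower s)))
      (λ s → lift (mono l _ _ (λ i → proj₂ (V≐W (as i))) (lower s)))
    sat-ren ρ V W V≐W (neg φ) = mk⇔
      (λ ¬s s → ¬s (from (sat-ren ρ V W V≐W φ) s))
      (λ ¬s s → ¬s (to (sat-ren ρ V W V≐W φ) s))
    sat-ren ρ V W V≐W (φ ∨ᶠ ψ) = mk⇔
      (λ { (inj₁ s) → inj₁ (to (sat-ren ρ V W V≐W φ) s)
         ; (inj₂ s) → inj₂ (to (sat-ren ρ V W V≐W ψ) s) })
      (λ { (inj₁ s) → inj₁ (from (sat-ren ρ V W V≐W φ) s)
         ; (inj₂ s) → inj₂ (from (sat-ren ρ V W V≐W ψ) s) })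
    sat-ren ρ V W V≐W (exᶠ φ) = mk⇔
      (λ (U , s) → U , to (sat-ren (liftFin 1 ρ) (U ∷ᵥ V) (U ∷ᵥ W) (extended U) φ) s)
      (λ (U , s) → U , from (sat-ren (liftFin 1 ρ) (U ∷ᵥ V) (U ∷ᵥ W) (extended U) φ) s)
      where
        extended : ∀ U i → (U ∷ᵥ V) (liftFin 1 ρ i) ≐ (U ∷ᵥ W) i
        extended U zero    = ≐-refl
        extended U (suc i) = V≐W i

  -- The encoded conjunctions mean what they should; the elimination direction
  -- is classical (¬¬-stability).
  module _ (em : ExcludedMiddle (lsuc 0ℓ)) where

    sat-∧ : ∀ {n X} {α : F X} {V : Fin n → Subsetˢ X} (φ ψ : Form n) →
            Sat X α V (φ ∧ᶠ ψ) ⇔ (Sat X α V φ × Sat X α V ψ)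
    sat-∧ φ ψ = mk⇔
      (λ s → decidable-stable em (s ∘ inj₁) , decidable-stable em (s ∘ inj₂))
      (λ { (sφ , sψ) (inj₁ ¬sφ) → ¬sφ sφ ; (sφ , sψ) (inj₂ ¬sψ) → ¬sψ sψ })

    sat-conjoin : ∀ j {n X} {α : F X} {V : Fin n → Subsetˢ X}
                  (f : Fin j → Form n) (ψ : Form n) →
                  Sat X α V (conjoin j f ψ) ⇔ ((∀ i → Sat X α V (f i)) × Sat X α V ψ)
    sat-conjoin zero    f ψ = mk⇔ (λ s → (λ ()) , s) proj₂
    sat-conjoin (suc j) f ψ = mk⇔
      (λ s → let (s₀ , s′) = to (sat-∧ (head f) _) s
                 (sᵢ , sψ) = to (sat-conjoin j (tail f) ψ) s′
             in (λ { zero → s₀ ; (suc i) → sᵢ i }) , sψ)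
      (λ (sᵢ , sψ) → from (sat-∧ (head f) _)
         (sᵢ zero , from (sat-conjoin j (tail f) ψ) (sᵢ ∘ suc , sψ)))

  module _ (mono : ∀ l → MonotoneLifting (Λ l)) (em : ExcludedMiddle (lsuc 0ℓ)) where

    sat-Mon : ∀ {k X} {α : F X} (V : Fin k → Subsetˢ X) (φ : Form k) →
              Sat X α V (Mon φ) ⇔
              Σ (Vector (Subsetˢ X) k) λ W → (∀ i → W i ⊆ V i) × Sat X α W φ
    sat-Mon {k} {X} {α} V φ = ⇔-trans (sat-exs k V _)
      (mk⇔ (λ (W , s) → W , to (unfold W) s) (λ (W , r) → W , from (unfold W) r))
      where
        bounded : (W : Vector (Subsetˢ X) k) →
                  (∀ i → Sat X α (W ⊕ V) (bounds k i)) ⇔ (∀ i → W i ⊆ V i)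
        bounded W = mk⇔ below above
          where
            below : (∀ i → Sat X α (W ⊕ V) (bounds k i)) → ∀ i → W i ⊆ V i
            below b i = ⊆-subst (⊕-↑ˡ W V i) (⊕-↑ʳ W V i) (lower (b i))

            above : (∀ i → W i ⊆ V i) → ∀ i → Sat X α (W ⊕ V) (bounds k i)
            above W⊆V i = lift (⊆-subst (sym (⊕-↑ˡ W V i)) (sym (⊕-↑ʳ W V i)) (W⊆V i))

        renamed : (W : Vector (Subsetˢ X) k) →
                  Sat X α (W ⊕ V) (ren (_↑ˡ k) φ) ⇔ Sat X α W φ
        renamed W = sat-ren mono (_↑ˡ k) (W ⊕ V) W
                      (λ i → subst ((W ⊕ V) (i ↑ˡ k) ≐_) (⊕-↑ˡ W V i) ≐-refl) φ

        unfold : (W : Vector (Subsetˢ X) k) →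
                 Sat X α (W ⊕ V) (conjoin k (bounds k) (ren (_↑ˡ k) φ)) ⇔
                 ((∀ i → W i ⊆ V i) × Sat X α W φ)
        unfold W = ⇔-trans (sat-conjoin em k (bounds k) _) (bounded W ×-⇔ renamed W)

    Mon-monotone : ∀ {k} (φ : Form k) → MonotoneForm (Mon φ)
    Mon-monotone {k} φ X α V V′ V⊆V′ s = from (sat-Mon V′ φ) (enlarge (to (sat-Mon V φ) s))
      where
        enlarge : Σ (Vector (Subsetˢ X) k) (λ W → (∀ i → W i ⊆ V i) × Sat X α W φ) →
                  Σ (Vector (Subsetˢ X) k) (λ W → (∀ i → W i ⊆ V′ i) × Sat X α W φ)
        enlarge (W , W⊆V , sφ) = W , (λ i {x} x∈W → V⊆V′ i (W⊆V i x∈W)) , sφ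

    Mon-intro : ∀ {k X} {α : F X} (V : Fin k → Subsetˢ X) (φ : Form k) →
                Sat X α V φ → Sat X α V (Mon φ)
    Mon-intro V φ s = from (sat-Mon V φ) (V , (λ _ → id) , s)

    -- Any valuation V has one below it satisfying φ as soon as V satisfies
    -- Mon φ (chosen by a classical case split on whether it does).
    Mon-shrink : ∀ {k X} {α : F X} (V : Fin k → Subsetˢ X) (φ : Form k) →
                 Σ (Vector (Subsetˢ X) k) λ W →
                   (∀ i → W i ⊆ V i) × (Sat X α V (Mon φ) → Sat X α W φ)
    Mon-shrink {X = X} {α} V φ with em {Sat X α V (Mon φ)}
    ... | yes s = let (W , W⊆V , sφ) = to (sat-Mon V φ) s in W , W⊆V , λ _ → sφ
    ... | no ¬s = V , (λ _ → id) , λ s → ⊥-elim (¬s s)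

-- Two automata differing only in their transition formulas play acceptance
-- games with the same positions, moves of ∀ and priorities.
module Simulation (T : SetFunctor) {L : Set} (Λ : L → PredLifting T) {m : ℕ}
  (k : ℕ) (Ω : Fin k → ℕ) (aI : Fin k) (𝕊 : OneStep.TreeModel T Λ m) where
  open OneStep T Λ

  withTransitions : (Fin k → Subset m → Form k) → Automaton m
  withTransitions Δ = record { k = k ; Δ = Δ ; Ω = Ω ; aI = aI }

  module _ (Δ₁ Δ₂ : Fin k → Subset m → Form k) where
    private
      module G₁ = Game (withTransitions Δ₁) 𝕊
      module G₂ = Game (withTransitions Δ₂) 𝕊
    open G₁ using (Pos; Choice; Answer; Strategy)

    answer-mono : (p q : Pos) {U U′ : Choice p} →
                  (∀ b → U b ⊆ U′ b) → Answer p U q → Answer p U′ q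
    answer-mono p q U⊆U′ (r , t∈U) = r , U⊆U′ (proj₁ q) t∈U

    -- If g always proposes a subvaluation of f's move, legal in game 1
    -- whenever f's move is legal in game 2, then g wins game 1 wherever f
    -- wins game 2: every play along g is a play along f.
    simulate : (f g : Strategy) →
               (∀ h p b → g h p b ⊆ f h p b) →
               (∀ h p → G₂.Legal p (f h p) → G₁.Legal p (g h p)) →
               ∀ {p₀} → G₂.Winning f p₀ → G₁.Winning g p₀
    simulate f g g⊆f legal {p₀} (legal₂ , parity₂) =
      (λ r → legal _ _ (legal₂ (reach r))) ,
      (λ ρ (ρ₀ , moves) → parity₂ ρ (ρ₀ , λ i →
         answer-mono (ρ i) (ρ (suc i)) (g⊆f (map ρ (upTo i)) (ρ i)) (moves i)))
      where
        reach : ∀ {h p} → G₁.Reach g p₀ h p → G₂.Reach f p₀ h p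
        reach G₁.start                     = G₂.start
        reach (G₁.step {h} {p} {q} r move) = G₂.step (reach r) (answer-mono p q (g⊆f h p) move)

module Closure (T : SetFunctor) {L : Set} (Λ : L → PredLifting T)
  (mono : ∀ l → MonotoneLifting (Λ l)) (em : ExcludedMiddle (lsuc 0ℓ)) where
  open OneStep T Λ
  open Formulas T Λ

  closure : ∀ {m} → Automaton m → Automaton m
  closure 𝔸 = record 𝔸 { Δ = λ a c → Mon (Automaton.Δ 𝔸 a c) }

  closure-monotone : ∀ {m} (𝔸 : Automaton m) → MonotoneAutomaton (closure 𝔸)
  closure-monotone 𝔸 a c = Mon-monotone mono em (Automaton.Δ 𝔸 a c)

  closure-equivalent : ∀ {m} (𝔸 : Automaton m) → EquivOverTrees 𝔸 (closure 𝔸)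
  closure-equivalent 𝔸 𝕊 = mk⇔ forward backward
    where
      open Automaton 𝔸
      open TreeModel 𝕊 using (col)
      open Game 𝔸 𝕊 using (Pos; Choice; Strategy; Legal)
      open Simulation T Λ k Ω aI 𝕊

      ΔMon : Fin k → Subset _ → Form k
      ΔMon a c = Mon (Δ a c)

      forward : Accepts 𝔸 𝕊 → Accepts (closure 𝔸) 𝕊
      forward (f , wins) =
        f , simulate ΔMon Δ f f (λ _ _ _ → id)
              (λ h (a , s) → Mon-intro mono em (f h (a , s)) (Δ a (col s))) wins

      backward : Accepts (closure 𝔸) 𝕊 → Accepts 𝔸 𝕊
      backward (f , wins) =
        g , simulate Δ ΔMon f g (λ h p → proj₁ (proj₂ (shrink h p)))
              (λ h p → proj₂ (proj₂ (shrink h p))) wins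
        where
          shrink : (h : List Pos) (p : Pos) →
                   Σ (Choice p) λ U → (∀ b → U b ⊆ f h p b) ×
                     (Game.Legal (closure 𝔸) 𝕊 p (f h p) → Legal p U)
          shrink h (a , s) = Mon-shrink mono em (f h (a , s)) (Δ a (col s))

          g : Strategy
          g h p = proj₁ (shrink h p)

mainTheorem7 : ((ℓ : Level) → ExcludedMiddle ℓ) →
    (T : SetFunctor) (L : Set) (Λ : L → PredLifting T) →
    (∀ l → MonotoneLifting (Λ l)) →
    ∀ {m} (𝔸 : OneStep.Automaton T Λ m) →
    Σ (OneStep.Automaton T Λ m) λ 𝔹 →
      OneStep.MonotoneAutomaton T Λ 𝔹 × OneStep.EquivOverTrees T Λ 𝔸 𝔹
mainTheorem7 em T L Λ mono 𝔸 =
  closure 𝔸 , closure-monotone 𝔸 , closure-equivalent 𝔸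
  where open Closure T Λ mono (em (lsuc 0ℓ))
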